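{- Let $\varphi$ be a closed hypertrace formula over the finite set of propositional variables $\mathcal{X}$. Then $\mathcal{L}(\varphi)\neq\emptyset$ if and only if $\mathcal{L}(\mathtt{flatten}(\varphi,\mathcal{X},\emptyset))\neq\emptyset$.
   Context: Fix a finite set $\mathcal{X}$ of propositional variables. A trace is an infinite sequence of subsets of $\mathcal{X}$; $(2^{\mathcal{X}})^\omega$ is the set of all traces, $\tau[k]$ the $k$-th element of $\tau$. Hypertrace formulas over trace variables and (disjoint) time variables: $\varphi ::= \exists\pi\,\varphi \mid \exists^{T}\pi\,\varphi \mid \exists i\,\varphi \mid \neg\varphi \mid \varphi\vee\varphi \mid i<j \mid i=j \mid x(\pi,i)$ with $x\in\mathcal{X}$; $\forall,\forall^T,\wedge,\to,\leftrightarrow$ are the usual abbreviations; every variable is quantified at most once. For $T\subseteq(2^{\mathcal{X}})^\omega$ and assignments $\Pi_{\mathbb{T}}$ (trace variables to traces), $\Pi_{\mathbb{N}}$ (time variables to $\mathbb{N}$): $\exists\pi\,\varphi$ holds iff $\varphi$ holds after assigning to $\pi$ some trace in $(2^{\mathcal{X}})^\omega$; $\exists^T\pi\,\varphi$ iff it holds after assigning to $\pi$ some trace in $T$; $\exists i\,\varphi$ iff it holds after assigning to $i$ some natural number; Boolean connectives as usual; $i<j$, $i=j$ compare the assigned numbers; $x(\pi,i)$ holds iff $x\in\Pi_{\mathbb{T}}(\pi)[\Pi_{\mathbb{N}}(i)]$. $T\models\varphi$ iff some pair of assignments satisfies $\varphi$ over $T$; $\mathcal{L}(\varphi)=\{T\subseteq(2^{\mathcal{X}})^\omega\mid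 T\models\varphi\}$. $\mathtt{flatten}$: with $\mathcal{X}=\{x_0,\dots,x_n\}$ and $\pi_x$ fresh trace variables, $\mathtt{flatten}(\exists\pi\,\varphi,\mathcal{X},\mathcal{V})=\exists\pi_{x_0}\cdots\exists\pi_{x_n}\,\mathtt{flatten}(\varphi,\mathcal{X},\mathcal{V}\cup\{\pi\})$; $\mathtt{flatten}(\exists^T\pi\,\varphi,\mathcal{X},\mathcal{V})=\exists^T\pi\,\mathtt{flatten}(\varphi,\mathcal{X},\mathcal{V})$; $\mathtt{flatten}(\exists i\,\varphi,\mathcal{X},\mathcal{V})=\exists i\,\mathtt{flatten}(\varphi,\mathcal{X},\mathcal{V})$; $\mathtt{flatten}(x(\pi,i),\mathcal{X},\mathcal{V})$ is $x(\pi_x,i)$ if $\pi\in\mathcal{V}$ and $x(\pi,i)$ otherwise; atoms $i<j,i=j$ unchanged; commutes with $\neg,\vee$. -}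

module Defs where

open import Data.Nat using (ℕ; _<_)
import Data.Nat.Properties as ℕP
open import Data.Fin using (Fin)
import Data.Fin.Properties as FinP
open import Data.Bool using (Bool; true; if_then_else_)
open import Data.List using (List; []; _∷_; _++_; foldr; allFin)
open import Data.List.Membership.Propositional using (_∈_)
open import Data.List.Relation.Unary.Any using (any?)
open import Data.List.Relation.Unary.Unique.Propositional using (Unique)
open import Data.Product using (Σ; ∃; _×_; _,_)
open import Data.Sum using (_⊎_; inj₁; inj₂)
import Data.Sum.Properties as SumP
import Data.Product.Properties as ProdP
open import Relation.Nullary using (¬_; Dec; yes; no; does)
open import Relation.Binary.Definitions using (DecidableEquality)
open import Relation.Binary.PropositionalEquality using (_≡_)

-- Propositional variables: 𝒳 = {x₀,…,x_{m-1}} represented by Fin m.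
-- A subset of 𝒳 is its characteristic function; a trace is an
-- infinite sequence of subsets.
Trace : ℕ → Set
Trace m = ℕ → (Fin m → Bool)

TimeVar : Set
TimeVar = ℕ

data Formula (m : ℕ) (V : Set) : Set where
  ex    : V → Formula m V → Formula m V
  exT   : V → Formula m V → Formula m V
  exN   : TimeVar → Formula m V → Formula m V
  neg   : Formula m V → Formula m V
  or    : Formula m V → Formula m V → Formula m V
  lt    : TimeVar → TimeVar → Formula m V
  eqN   : TimeVar → TimeVar → Formula m V
  atom  : Fin m → V → TimeVar → Formula m V

module _ {m : ℕ} {V : Set} (_≟V_ : DecidableEquality V) where

  updT : (V → Trace m) → V → Trace m → (V → Trace m)
  updT Π π t π' = if does (π' ≟V π) then t else Π π'

  updN : (TimeVar → ℕ) → TimeVar → ℕ → (TimeVar → ℕ)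
  updN Π i n j = if does (j ℕP.≟ i) then n else Π j

  Sat : (T : Trace m → Set) → (V → Trace m) → (TimeVar → ℕ) → Formula m V → Set
  Sat T ΠT ΠN (ex π φ)   = Σ (Trace m) λ t → Sat T (updT ΠT π t) ΠN φ
  Sat T ΠT ΠN (exT π φ)  = Σ (Trace m) λ t → T t × Sat T (updT ΠT π t) ΠN φ
  Sat T ΠT ΠN (exN i φ)  = Σ ℕ λ n → Sat T ΠT (updN ΠN i n) φ
  Sat T ΠT ΠN (neg φ)    = ¬ Sat T ΠT ΠN φ
  Sat T ΠT ΠN (or φ ψ)   = Sat T ΠT ΠN φ ⊎ Sat T ΠT ΠN ψ
  Sat T ΠT ΠN (lt i j)   = ΠN i < ΠN j
  Sat T ΠT ΠN (eqN i j)  = ΠN i ≡ ΠN j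
  Sat T ΠT ΠN (atom x π i) = ΠT π (ΠN i) x ≡ true

  _⊨_ : (Trace m → Set) → Formula m V → Set
  T ⊨ φ = Σ (V → Trace m) λ ΠT → Σ (TimeVar → ℕ) λ ΠN → Sat T ΠT ΠN φ

  LNonempty : Formula m V → Set₁
  LNonempty φ = Σ (Trace m → Set) λ T → T ⊨ φ

Scoped : {m : ℕ} {V : Set} → List V → List TimeVar → Formula m V → Set
Scoped Γ Δ (ex π φ)     = Scoped (π ∷ Γ) Δ φ
Scoped Γ Δ (exT π φ)    = Scoped (π ∷ Γ) Δ φ
Scoped Γ Δ (exN i φ)    = Scoped Γ (i ∷ Δ) φ
Scoped Γ Δ (neg φ)      = Scoped Γ Δ φ
Scoped Γ Δ (or φ ψ)     = Scoped Γ Δ φ × Scoped Γ Δ ψ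
Scoped Γ Δ (lt i j)     = i ∈ Δ × j ∈ Δ
Scoped Γ Δ (eqN i j)    = i ∈ Δ × j ∈ Δ
Scoped Γ Δ (atom x π i) = π ∈ Γ × i ∈ Δ

Closed : {m : ℕ} {V : Set} → Formula m V → Set
Closed φ = Scoped [] [] φ

boundT : {m : ℕ} {V : Set} → Formula m V → List V
boundT (ex π φ)   = π ∷ boundT φ
boundT (exT π φ)  = π ∷ boundT φ
boundT (exN i φ)  = boundT φ
boundT (neg φ)    = boundT φ
boundT (or φ ψ)   = boundT φ ++ boundT ψ
boundT (lt i j)   = []
boundT (eqN i j)  = []
boundT (atom x π i) = []

boundN : {m : ℕ} {V : Set} → Formula m V → List TimeVar
boundN (ex π φ)   = boundN φ
boundN (exT π φ)  = boundN φ
boundN (exN i φ)  = i ∷ boundN φ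
boundN (neg φ)    = boundN φ
boundN (or φ ψ)   = boundN φ ++ boundN ψ
boundN (lt i j)   = []
boundN (eqN i j)  = []
boundN (atom x π i) = []

QuantifiedOnce : {m : ℕ} {V : Set} → Formula m V → Set
QuantifiedOnce φ = Unique (boundT φ) × Unique (boundN φ)

-- Input trace variables are natural numbers; flatten produces formulas
-- whose trace variables are either original ones (inj₁ π) or the fresh
-- variables π_x = inj₂ (π , x).
FVar : ℕ → Set
FVar m = ℕ ⊎ (ℕ × Fin m)

_≟F_ : {m : ℕ} → DecidableEquality (FVar m)
_≟F_ = SumP.≡-dec ℕP._≟_ (ProdP.≡-dec ℕP._≟_ FinP._≟_)

exAll : {m : ℕ} → ℕ → Formula m (FVar m) → Formula m (FVar m)
exAll {m} π ψ = foldr (λ x ψ' → ex (inj₂ (π , x)) ψ') ψ (allFin m)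

flatten : {m : ℕ} → Formula m ℕ → List ℕ → Formula m (FVar m)
flatten (ex π φ)  𝒱    = exAll π (flatten φ (π ∷ 𝒱))
flatten (exT π φ) 𝒱    = exT (inj₁ π) (flatten φ 𝒱)
flatten (exN i φ) 𝒱    = exN i (flatten φ 𝒱)
flatten (neg φ)   𝒱    = neg (flatten φ 𝒱)
flatten (or φ ψ)  𝒱    = or (flatten φ 𝒱) (flatten ψ 𝒱)
flatten (lt i j)  𝒱    = lt i j
flatten (eqN i j) 𝒱    = eqN i j
flatten (atom x π i) 𝒱 =
  if does (any? (ℕP._≟_ π) 𝒱) then atom x (inj₂ (π , x)) i else atom x (inj₁ π) i

{-# OPTIONS --safe #-}
-- An existential ∃π is replaced by one quantifier ∃π_x per proposition x, and an
-- atom x(π, i) reads only the x-component of π, now stored in π_x.  Since ∃π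
-- ranges over all traces, a witness t for π gives the witnesses π_x := t, and
-- conversely witnesses for the π_x glue to the trace n ↦ x ↦ π_x[n](x).  By
-- induction on φ, satisfaction is therefore preserved between any two trace
-- assignments related in this way.  Uniqueness of quantified variables is what
-- keeps an inner ∃^T π from being captured by the flattened copies of an outer ∃π.
module Submission where

open import Defs
open import Data.Nat using (ℕ)
import Data.Nat.Properties as ℕP
open import Data.Bool using (true; false; if_then_else_)
open import Data.Bool.Properties using (if-float)
open import Data.Fin as Fin using (Fin)
open import Data.List using (List; []; _∷_; _++_; foldr; allFin)
open import Data.List.Membership.Propositional using (_∈_; _∉_)
open import Data.List.Membership.Propositional.Properties using (∈-allFin; ∈-++⁺ˡ; ∈-++⁺ʳ)
open import Data.List.Relation.Binary.Disjoint.Propositional using (Disjoint; contractᵣ)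
import Data.List.Relation.Unary.All as All
import Data.List.Relation.Unary.All.Properties as All
open import Data.List.Relation.Unary.AllPairs using (_∷_; [])
open import Data.List.Relation.Unary.Any using (any?; here; there)
open import Data.List.Relation.Unary.Unique.Propositional using (Unique)
open import Data.Product using (Σ; _×_; _,_; proj₁; map₂)
open import Data.Product.Function.Dependent.Propositional using (Σ-⇔)
open import Data.Product.Function.NonDependent.Propositional using (_×-⇔_)
open import Data.Sum using (inj₁; inj₂; [_,_])
open import Data.Sum.Function.Propositional using (_⊎-⇔_)
open import Function using (_∘_; const)
open import Function.Bundles using (_⇔_; mk⇔; Equivalence)
open import Function.Construct.Identity using (↠-id; ⇔-id)
open import Function.Related.TypeIsomorphisms using (¬-cong-⇔)
open import Relation.Nullary using (does; yes; no)
open import Relation.Nullary.Decidable using (dec-true; dec-false)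
open import Relation.Binary.Definitions using (DecidableEquality)
open import Relation.Binary.PropositionalEquality
  using (_≡_; _≢_; refl; sym; trans; cong; module ≡-Reasoning)

open Equivalence using (to; from)

module _ {m : ℕ} {V : Set} (_≟_ : DecidableEquality V) (Π : V → Trace m) (v : V) (t : Trace m) where

  updT-same : updT _≟_ Π v t v ≡ t
  updT-same = cong (if_then t else Π v) (dec-true (v ≟ v) refl)

  updT-other : ∀ {w} → w ≢ v → updT _≟_ Π v t w ≡ Π w
  updT-other {w} w≢v = cong (if_then t else Π w) (dec-false (w ≟ v) w≢v)

private
  at : ∀ {m} {τ τ' : Trace m} n x → τ ≡ τ' → τ n x ≡ τ' n x
  at n x = cong (λ τ → τ n x)

Unique-++⁻ˡ : ∀ {A : Set} (xs : List A) {ys} → Unique (xs ++ ys) → Unique xs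
Unique-++⁻ˡ []       _         = []
Unique-++⁻ˡ (x ∷ xs) (x∉ ∷ u) = All.++⁻ˡ xs x∉ ∷ Unique-++⁻ˡ xs u

Unique-++⁻ʳ : ∀ {A : Set} (xs : List A) {ys} → Unique (xs ++ ys) → Unique ys
Unique-++⁻ʳ []       u        = u
Unique-++⁻ʳ (x ∷ xs) (_ ∷ u) = Unique-++⁻ʳ xs u

module _ {m : ℕ} where

  Assignment : Set
  Assignment = FVar m → Trace m

  root : FVar m → ℕ
  root (inj₁ π)       = π
  root (inj₂ (π , _)) = π

  flatVar : List ℕ → ℕ → Fin m → FVar m
  flatVar 𝒱 π x = if does (any? (π ℕP.≟_) 𝒱) then inj₂ (π , x) else inj₁ π

  flatten-atom : ∀ 𝒱 x π i → flatten (atom x π i) 𝒱 ≡ atom x (flatVar 𝒱 π x) i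
  flatten-atom 𝒱 x π i = sym (if-float (λ v → atom x v i) (does (any? (π ℕP.≟_) 𝒱)))

  flatVar-root : ∀ 𝒱 π x → root (flatVar 𝒱 π x) ≡ π
  flatVar-root 𝒱 π x = trans (if-float root (does (any? (π ℕP.≟_) 𝒱))) (if-same _)
    where
    if-same : ∀ b → (if b then π else π) ≡ π
    if-same true  = refl
    if-same false = refl

  flatVar-here : ∀ 𝒱 π x → flatVar (π ∷ 𝒱) π x ≡ inj₂ (π , x)
  flatVar-here 𝒱 π x =
    cong (if_then inj₂ (π , x) else inj₁ π) (dec-true (any? (π ℕP.≟_) (π ∷ 𝒱)) (here refl))

  flatVar-there : ∀ 𝒱 {π π'} x → π' ≢ π → flatVar (π ∷ 𝒱) π' x ≡ flatVar 𝒱 π' x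
  flatVar-there 𝒱 {π} {π'} x π'≢π rewrite dec-false (π' ℕP.≟ π) π'≢π = refl

  flatVar-∉ : ∀ {𝒱 π} x → π ∉ 𝒱 → flatVar 𝒱 π x ≡ inj₁ π
  flatVar-∉ {𝒱} {π} x π∉𝒱 =
    cong (if_then inj₂ (π , x) else inj₁ π) (dec-false (any? (π ℕP.≟_) 𝒱) π∉𝒱)

  Represents : List ℕ → Assignment → (ℕ → Trace m) → Set
  Represents 𝒱 ΠT' ΠT = ∀ π n x → ΠT π n x ≡ ΠT' (flatVar 𝒱 π x) n x

  AgreeAwayFrom : ℕ → Assignment → Assignment → Set
  AgreeAwayFrom π Π Π' = ∀ v → root v ≢ π → Π v ≡ Π' v

  exBlock : ℕ → Formula m (FVar m) → List (Fin m) → Formula m (FVar m)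
  exBlock π ψ xs = foldr (λ x ψ' → ex (inj₂ (π , x)) ψ') ψ xs

  updBlock : Assignment → ℕ → (Fin m → Trace m) → List (Fin m) → Assignment
  updBlock Π π f []       = Π
  updBlock Π π f (x ∷ xs) = updBlock (updT _≟F_ Π (inj₂ (π , x)) (f x)) π f xs

  updT-away : ∀ (Π : Assignment) {π} x t {v} → root v ≢ π →
    updT _≟F_ Π (inj₂ (π , x)) t v ≡ Π v
  updT-away Π x t root≢π = updT-other _≟F_ Π _ t (root≢π ∘ cong root)

  updBlock-away : ∀ Π π f xs → AgreeAwayFrom π (updBlock Π π f xs) Π
  updBlock-away Π π f []       v root≢π = refl
  updBlock-away Π π f (y ∷ xs) v root≢π =
    trans (updBlock-away _ π f xs v root≢π) (updT-away Π y (f y) root≢π)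

  updBlock-keeps : ∀ Π π f xs {x} → Π (inj₂ (π , x)) ≡ f x →
    updBlock Π π f xs (inj₂ (π , x)) ≡ f x
  updBlock-keeps Π π f []       eq = eq
  updBlock-keeps Π π f (y ∷ xs) {x} eq = updBlock-keeps _ π f xs step
    where
    step : updT _≟F_ Π (inj₂ (π , y)) (f y) (inj₂ (π , x)) ≡ f x
    step with x Fin.≟ y
    ... | yes refl = updT-same _≟F_ Π _ (f y)
    ... | no x≢y  = trans (updT-other _≟F_ Π (inj₂ (π , y)) (f y) λ { refl → x≢y refl }) eq

  updBlock-∈ : ∀ Π π f {xs x} → x ∈ xs → updBlock Π π f xs (inj₂ (π , x)) ≡ f x
  updBlock-∈ Π π f {y ∷ xs} (here refl) = updBlock-keeps _ π f xs (updT-same _≟F_ Π _ (f y))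
  updBlock-∈ Π π f {y ∷ xs} (there x∈xs) = updBlock-∈ _ π f x∈xs

  Represents-∷ : ∀ 𝒱 {π ΠT t} {ΠT' Π'' : Assignment} →
    Represents 𝒱 ΠT' ΠT → AgreeAwayFrom π Π'' ΠT' →
    (∀ n x → t n x ≡ Π'' (inj₂ (π , x)) n x) →
    Represents (π ∷ 𝒱) Π'' (updT ℕP._≟_ ΠT π t)
  Represents-∷ 𝒱 {π} {ΠT} {t} {ΠT'} {Π''} rep away t≡ π' n x with π' ℕP.≟ π
  ... | yes refl = begin
    updT ℕP._≟_ ΠT π t π n x   ≡⟨ at n x (updT-same ℕP._≟_ ΠT π t) ⟩
    t n x                      ≡⟨ t≡ n x ⟩
    Π'' (inj₂ (π , x)) n x     ≡⟨ at n x (cong Π'' (sym (flatVar-here 𝒱 π x))) ⟩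
    Π'' (flatVar (π ∷ 𝒱) π x) n x ∎
    where open ≡-Reasoning
  ... | no π'≢π = begin
    updT ℕP._≟_ ΠT π t π' n x  ≡⟨ at n x (updT-other ℕP._≟_ ΠT π t π'≢π) ⟩
    ΠT π' n x                  ≡⟨ rep π' n x ⟩
    ΠT' (flatVar 𝒱 π' x) n x   ≡⟨ at n x (sym (away _ root≢π)) ⟩
    Π'' (flatVar 𝒱 π' x) n x   ≡⟨ at n x (cong Π'' (sym (flatVar-there 𝒱 x π'≢π))) ⟩
    Π'' (flatVar (π ∷ 𝒱) π' x) n x ∎
    where
    open ≡-Reasoning
    root≢π : root (flatVar 𝒱 π' x) ≢ π
    root≢π = π'≢π ∘ trans (sym (flatVar-root 𝒱 π' x))

  Represents-updT : ∀ 𝒱 {π ΠT t} {ΠT' : Assignment} → π ∉ 𝒱 →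
    Represents 𝒱 ΠT' ΠT → Represents 𝒱 (updT _≟F_ ΠT' (inj₁ π) t) (updT ℕP._≟_ ΠT π t)
  Represents-updT 𝒱 {π} {ΠT} {t} {ΠT'} π∉𝒱 rep π' n x with π' ℕP.≟ π
  ... | yes refl = begin
    updT ℕP._≟_ ΠT π t π n x ≡⟨ at n x (updT-same ℕP._≟_ ΠT π t) ⟩
    t n x                    ≡⟨ at n x (sym (updT-same _≟F_ ΠT' (inj₁ π) t)) ⟩
    ΠT'₁ (inj₁ π) n x        ≡⟨ at n x (cong ΠT'₁ (sym (flatVar-∉ x π∉𝒱))) ⟩
    ΠT'₁ (flatVar 𝒱 π x) n x ∎
    where
    open ≡-Reasoning
    ΠT'₁ = updT _≟F_ ΠT' (inj₁ π) t
  ... | no π'≢π = begin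
    updT ℕP._≟_ ΠT π t π' n x ≡⟨ at n x (updT-other ℕP._≟_ ΠT π t π'≢π) ⟩
    ΠT π' n x                 ≡⟨ rep π' n x ⟩
    ΠT' (flatVar 𝒱 π' x) n x  ≡⟨ at n x (sym (updT-other _≟F_ ΠT' (inj₁ π) t v≢π)) ⟩
    updT _≟F_ ΠT' (inj₁ π) t (flatVar 𝒱 π' x) n x ∎
    where
    open ≡-Reasoning
    v≢π : flatVar 𝒱 π' x ≢ inj₁ π
    v≢π eq = π'≢π (trans (sym (flatVar-root 𝒱 π' x)) (cong root eq))

module _ {m : ℕ} {T : Trace m → Set} where

  exBlock-intro : ∀ {Π ΠN π ψ} f xs →
    Sat _≟F_ T (updBlock Π π f xs) ΠN ψ → Sat _≟F_ T Π ΠN (exBlock π ψ xs)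
  exBlock-intro f []       s = s
  exBlock-intro f (x ∷ xs) s = f x , exBlock-intro f xs s

  exBlock-elim : ∀ {Π ΠN π ψ} xs → Sat _≟F_ T Π ΠN (exBlock π ψ xs) →
    Σ Assignment λ Π'' → AgreeAwayFrom π Π'' Π × Sat _≟F_ T Π'' ΠN ψ
  exBlock-elim []       s = _ , (λ _ _ → refl) , s
  exBlock-elim {Π} {π = π} (x ∷ xs) (t , s) with exBlock-elim xs s
  ... | Π'' , away , s'' = Π'' , (λ v root≢π → trans (away v root≢π) (updT-away Π x t root≢π)) , s''

  Sat-flatten : ∀ φ 𝒱 {ΠT ΠT' ΠN} → Unique (boundT φ) → Disjoint 𝒱 (boundT φ) →
    Represents 𝒱 ΠT' ΠT → Sat ℕP._≟_ T ΠT ΠN φ ⇔ Sat _≟F_ T ΠT' ΠN (flatten φ 𝒱)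
  Sat-flatten (ex π φ) 𝒱 {ΠT} {ΠT'} {ΠN} (π∉φ ∷ u) 𝒱#φ rep = mk⇔ intro elim
    where
    π∷𝒱#φ : Disjoint (π ∷ 𝒱) (boundT φ)
    π∷𝒱#φ (here refl , π∈φ) = All.lookup π∉φ π∈φ refl
    π∷𝒱#φ (there v∈𝒱 , v∈φ) = 𝒱#φ (v∈𝒱 , there v∈φ)

    IH : ∀ {t} {Π'' : Assignment} → AgreeAwayFrom π Π'' ΠT' →
      (∀ n x → t n x ≡ Π'' (inj₂ (π , x)) n x) →
      Sat ℕP._≟_ T (updT ℕP._≟_ ΠT π t) ΠN φ ⇔ Sat _≟F_ T Π'' ΠN (flatten φ (π ∷ 𝒱))
    IH away t≡ = Sat-flatten φ (π ∷ 𝒱) u π∷𝒱#φ (Represents-∷ 𝒱 rep away t≡)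

    intro : Sat ℕP._≟_ T ΠT ΠN (ex π φ) → Sat _≟F_ T ΠT' ΠN (flatten (ex π φ) 𝒱)
    intro (t , s) = exBlock-intro (const t) (allFin m) (to (IH away t≡) s)
      where
      away = updBlock-away ΠT' π (const t) (allFin m)
      t≡ = λ n x → at n x (sym (updBlock-∈ ΠT' π (const t) (∈-allFin x)))

    elim : Sat _≟F_ T ΠT' ΠN (flatten (ex π φ) 𝒱) → Sat ℕP._≟_ T ΠT ΠN (ex π φ)
    elim s with exBlock-elim (allFin m) s
    ... | Π'' , away , s'' = glued , from (IH away λ _ _ → refl) s''
      where
      glued : Trace m
      glued n x = Π'' (inj₂ (π , x)) n x
  Sat-flatten (exT π φ) 𝒱 {ΠT' = ΠT'} (_ ∷ u) 𝒱#φ rep = Σ-⇔ (↠-id _) λ {t} →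
    ⇔-id (T t) ×-⇔ Sat-flatten φ 𝒱 u (contractᵣ 𝒱#φ) (Represents-updT 𝒱 {ΠT' = ΠT'} π∉𝒱 rep)
    where
    π∉𝒱 : π ∉ 𝒱
    π∉𝒱 π∈𝒱 = 𝒱#φ (π∈𝒱 , here refl)
  Sat-flatten (exN i φ) 𝒱 u 𝒱#φ rep = Σ-⇔ (↠-id ℕ) (Sat-flatten φ 𝒱 u 𝒱#φ rep)
  Sat-flatten (neg φ)   𝒱 u 𝒱#φ rep = ¬-cong-⇔ (Sat-flatten φ 𝒱 u 𝒱#φ rep)
  Sat-flatten (or φ ψ)  𝒱 u 𝒱#φψ rep =
    Sat-flatten φ 𝒱 (Unique-++⁻ˡ (boundT φ) u) (λ (v∈𝒱 , v∈φ) → 𝒱#φψ (v∈𝒱 , ∈-++⁺ˡ v∈φ)) rep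
    ⊎-⇔
    Sat-flatten ψ 𝒱 (Unique-++⁻ʳ (boundT φ) u) (λ (v∈𝒱 , v∈ψ) → 𝒱#φψ (v∈𝒱 , ∈-++⁺ʳ _ v∈ψ)) rep
  Sat-flatten (lt i j)  _ _ _ _ = ⇔-id _
  Sat-flatten (eqN i j) _ _ _ _ = ⇔-id _
  Sat-flatten (atom x π i) 𝒱 {ΠN = ΠN} _ _ rep rewrite flatten-atom 𝒱 x π i =
    mk⇔ (trans (sym (rep π (ΠN i) x))) (trans (rep π (ΠN i) x))

  ⊨-flatten : ∀ {φ} → Unique (boundT φ) → _⊨_ ℕP._≟_ T φ ⇔ _⊨_ _≟F_ T (flatten φ [])
  ⊨-flatten {φ} u = mk⇔
    (λ (ΠT , ΠN , s) → [ ΠT , ΠT ∘ proj₁ ] , ΠN , to (Sat-flatten φ [] u (λ ()) λ _ _ _ → refl) s)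
    (λ (ΠT' , ΠN , s) → ΠT' ∘ inj₁ , ΠN , from (Sat-flatten φ [] u (λ ()) λ _ _ _ → refl) s)

corollary1 : (m : ℕ) (φ : Formula m ℕ) → Closed φ → QuantifiedOnce φ →
    LNonempty ℕP._≟_ φ ⇔ LNonempty _≟F_ (flatten φ [])
corollary1 m φ _ (unique , _) =
  mk⇔ (map₂ (to (⊨-flatten unique))) (map₂ (from (⊨-flatten unique)))
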